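{- Let $A_1,\dots,A_n$ be pairwise disjoint c.e. sets such that the complement of $A_1\cup\dots\cup A_n$ is infinite. Then $\omega\leq R_{A_1,\dots,A_n}$ if and only if $A_1\cup\dots\cup A_n$ is not simple.
   Context: A ceer is an equivalence relation on $\mathbb N$ c.e. as a subset of $\mathbb N^2$; $R_1\leq R_2$ means there is a total computable $f$ with $xR_1y\Leftrightarrow f(x)R_2f(y)$. $\omega$ is the identity relation on $\mathbb N$. For pairwise disjoint c.e. sets $A_1,\dots,A_n$, $xR_{A_1,\dots,A_n}y\Leftrightarrow x=y\lor\exists i\leq n\,(x,y\in A_i)$. A c.e. set $A$ is simple if its complement is infinite and $A$ meets every infinite c.e. set. -}

module Defs where

open import Level using (0ℓ)
open import Data.Nat using (ℕ; zero; suc; _≤_; _<_)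
open import Data.Fin using (Fin)
open import Data.Vec using (Vec; []; _∷_; lookup)
open import Data.Product using (Σ; ∃; _×_; _,_)
open import Data.Sum using (_⊎_)
open import Relation.Nullary using (¬_)
open import Relation.Unary using (Pred)
open import Relation.Binary.PropositionalEquality using (_≡_)
open import Function.Bundles using (_⇔_)

data PR : ℕ → Set where
  zer  : ∀ {n} → PR n
  succ : PR 1
  proj : ∀ {n} → Fin n → PR n
  comp : ∀ {m n} → PR m → Vec (PR n) m → PR n
  prec : ∀ {n} → PR n → PR (suc (suc n)) → PR (suc n)
  mu   : ∀ {n} → PR (suc n) → PR n

data _[_]⇓_ : ∀ {n} → PR n → Vec ℕ n → ℕ → Set
data _[_]⇓*_ : ∀ {m n} → Vec (PR n) m → Vec ℕ n → Vec ℕ m → Set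

data _[_]⇓_ where
  zer⇓  : ∀ {n} {xs : Vec ℕ n} → zer [ xs ]⇓ 0
  succ⇓ : ∀ {x} → succ [ x ∷ [] ]⇓ suc x
  proj⇓ : ∀ {n} {i : Fin n} {xs} → proj i [ xs ]⇓ lookup xs i
  comp⇓ : ∀ {m n} {f : PR m} {gs : Vec (PR n) m} {xs ys y} →
          gs [ xs ]⇓* ys → f [ ys ]⇓ y → comp f gs [ xs ]⇓ y
  prec0 : ∀ {n} {g : PR n} {h xs y} → g [ xs ]⇓ y → prec g h [ 0 ∷ xs ]⇓ y
  precS : ∀ {n} {g : PR n} {h xs k r y} →
          prec g h [ k ∷ xs ]⇓ r → h [ k ∷ r ∷ xs ]⇓ y →
          prec g h [ suc k ∷ xs ]⇓ y
  mu⇓   : ∀ {n} {f : PR (suc n)} {xs y} →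
          f [ y ∷ xs ]⇓ 0 →
          (∀ z → z < y → Σ ℕ λ k → f [ z ∷ xs ]⇓ suc k) →
          mu f [ xs ]⇓ y

data _[_]⇓*_ where
  []⇓  : ∀ {n} {xs : Vec ℕ n} → [] [ xs ]⇓* []
  _∷⇓_ : ∀ {m n} {g : PR n} {gs : Vec (PR n) m} {xs y ys} →
         g [ xs ]⇓ y → gs [ xs ]⇓* ys → (g ∷ gs) [ xs ]⇓* (y ∷ ys)

Computable : (ℕ → ℕ) → Set
Computable f = Σ (PR 1) λ p → ∀ x → p [ x ∷ [] ]⇓ f x

Halts : PR 1 → ℕ → Set
Halts p x = ∃ λ y → p [ x ∷ [] ]⇓ y

CE : Pred ℕ 0ℓ → Set
CE A = Σ (PR 1) λ p → ∀ x → A x ⇔ Halts p x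

Infinite : Pred ℕ 0ℓ → Set
Infinite P = ∀ n → ∃ λ m → n ≤ m × P m

Complement : Pred ℕ 0ℓ → Pred ℕ 0ℓ
Complement A x = ¬ A x

Simple : Pred ℕ 0ℓ → Set₁
Simple A = CE A × Infinite (Complement A) ×
           (∀ (W : Pred ℕ 0ℓ) → CE W → Infinite W → ∃ λ x → W x × A x)

Rel : Set₁
Rel = ℕ → ℕ → Set

_≤c_ : Rel → Rel → Set
R₁ ≤c R₂ = Σ (ℕ → ℕ) λ f → Computable f × (∀ x y → R₁ x y ⇔ R₂ (f x) (f y))

ω : Rel
ω = _≡_

⋃ : ∀ {n} → (Fin n → Pred ℕ 0ℓ) → Pred ℕ 0ℓ
⋃ A x = ∃ λ i → A i x

PairwiseDisjoint : ∀ {n} → (Fin n → Pred ℕ 0ℓ) → Set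
PairwiseDisjoint A = ∀ i j x → A i x → A j x → i ≡ j

R[_] : ∀ {n} → (Fin n → Pred ℕ 0ℓ) → Rel
R[ A ] x y = x ≡ y ⊎ ∃ λ i → A i x × A i y

module Submission where

-- (⇒) A reduction f of ω to R_A is injective and never sends two distinct
--     numbers into the same Aᵢ.  Each tail image {f z ∣ z ≥ N} is an infinite
--     c.e. set, so if U were simple we could pick z₀ < z₁ < … < zₙ with every
--     f zₖ ∈ U; by pigeonhole two of them land in the same Aᵢ, contradiction.
-- (⇐) U is c.e. (dovetailing), so classically "not simple" yields an infinite
--     c.e. set W disjoint from U.  A strictly increasing computable
--     enumeration of W is then a reduction of ω to R_A, since its values are
--     distinct and never lie in any Aᵢ.

open import Defs
open import Level using (0ℓ)
open import Data.Nat using (ℕ; zero; suc; _≤_; _<_; _⊔_; s≤s; pred; _+_; _∸_; _≤?_)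
open import Data.Nat.Properties
open import Data.Fin using (Fin; #_; toℕ; fromℕ<; _↑ʳ_) renaming (zero to fz; suc to fs)
open import Data.Fin.Properties using (pigeonhole; toℕ-fromℕ<; any?)
open import Data.Vec using (Vec; []; _∷_; lookup; head; tail; map; tabulate; _++_)
open import Data.Vec.Properties using (tabulate∘lookup; tabulate-cong; lookup-++ʳ)
open import Data.Product using (Σ; ∃; ∃₂; _×_; _,_; proj₁; proj₂)
open import Data.Sum using (_⊎_; inj₁; inj₂)
open import Data.Empty using (⊥-elim)
open import Relation.Nullary using (¬_; yes; no)
open import Relation.Binary using (tri<; tri≈; tri>)
open import Relation.Unary using (Pred)
open import Relation.Binary.PropositionalEquality using (_≡_; refl; sym; trans; cong; cong₂; subst)
open import Function.Bundles using (_⇔_; mk⇔; Equivalence)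
open import Axiom.ExcludedMiddle using (ExcludedMiddle)
open import Axiom.DoubleNegationElimination using (DoubleNegationElimination; em⇒dne)

cond : ℕ → ℕ → ℕ → ℕ
cond zero    b c = b
cond (suc _) b c = c

condP : PR 3
condP = prec (proj fz) (proj (# 3))

condP⇓ : ∀ a b c → condP [ a ∷ b ∷ c ∷ [] ]⇓ cond a b c
condP⇓ zero    b c = prec0 proj⇓
condP⇓ (suc a) b c = precS (condP⇓ a b c) proj⇓

predP : PR 1
predP = prec zer (proj fz)

predP⇓ : ∀ a → predP [ a ∷ [] ]⇓ pred a
predP⇓ zero    = prec0 zer⇓
predP⇓ (suc a) = precS (predP⇓ a) proj⇓

addP : PR 2
addP = prec (proj fz) (comp succ (proj (# 1) ∷ []))

addP⇓ : ∀ a b → addP [ a ∷ b ∷ [] ]⇓ (a + b)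
addP⇓ zero    b = prec0 proj⇓
addP⇓ (suc a) b = precS (addP⇓ a b) (comp⇓ (proj⇓ ∷⇓ []⇓) succ⇓)

monusP : PR 2
monusP = prec (proj fz) (comp predP (proj (# 1) ∷ []))

monusP⇓ : ∀ b a → monusP [ b ∷ a ∷ [] ]⇓ (a ∸ b)
monusP⇓ zero    a = prec0 proj⇓
monusP⇓ (suc b) a = subst (monusP [ suc b ∷ a ∷ [] ]⇓_) (pred[m∸n]≡m∸[1+n] a b)
                      (precS (monusP⇓ b a) (comp⇓ (proj⇓ ∷⇓ []⇓) (predP⇓ _)))

module _ {n : ℕ} where

  ifz : PR n → PR n → PR n → PR n
  ifz a b c = comp condP (a ∷ b ∷ c ∷ [])

  dec inc : PR n → PR n
  dec a = comp predP (a ∷ [])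
  inc a = comp succ (a ∷ [])

  one : PR n
  one = inc zer

  const : ℕ → PR n
  const zero    = zer
  const (suc k) = inc (const k)

  add monus : PR n → PR n → PR n
  add a b   = comp addP (a ∷ b ∷ [])
  monus a b = comp monusP (b ∷ a ∷ [])

  private variable
    a b c : PR n
    xs : Vec ℕ n
    A B C : ℕ

  ifz⇓ : a [ xs ]⇓ A → b [ xs ]⇓ B → c [ xs ]⇓ C → ifz a b c [ xs ]⇓ cond A B C
  ifz⇓ da db dc = comp⇓ (da ∷⇓ (db ∷⇓ (dc ∷⇓ []⇓))) (condP⇓ _ _ _)

  dec⇓ : a [ xs ]⇓ A → dec a [ xs ]⇓ pred A
  dec⇓ da = comp⇓ (da ∷⇓ []⇓) (predP⇓ _)

  inc⇓ : a [ xs ]⇓ A → inc a [ xs ]⇓ suc A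
  inc⇓ da = comp⇓ (da ∷⇓ []⇓) succ⇓

  add⇓ : a [ xs ]⇓ A → b [ xs ]⇓ B → add a b [ xs ]⇓ (A + B)
  add⇓ da db = comp⇓ (da ∷⇓ (db ∷⇓ []⇓)) (addP⇓ _ _)

  monus⇓ : a [ xs ]⇓ A → b [ xs ]⇓ B → monus a b [ xs ]⇓ (A ∸ B)
  monus⇓ da db = comp⇓ (db ∷⇓ (da ∷⇓ []⇓)) (monusP⇓ _ _)

  one⇓ : ∀ {xs} → one [ xs ]⇓ 1
  one⇓ = inc⇓ zer⇓

  const⇓ : ∀ k {xs} → const k [ xs ]⇓ k
  const⇓ zero    = zer⇓
  const⇓ (suc k) = inc⇓ (const⇓ k)

projs : ∀ {m n} → (Fin n → Fin m) → Vec (PR m) n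
projs ρ = tabulate (λ i → proj (ρ i))

projs⇓ : ∀ {m n} (ρ : Fin n → Fin m) ys → projs ρ [ ys ]⇓* tabulate (λ i → lookup ys (ρ i))
projs⇓ {n = zero}  ρ ys = []⇓
projs⇓ {n = suc n} ρ ys = proj⇓ ∷⇓ projs⇓ (λ i → ρ (fs i)) ys

dropArgs : ∀ {m n} (ys : Vec ℕ m) (xs : Vec ℕ n) → projs (m ↑ʳ_) [ ys ++ xs ]⇓* xs
dropArgs {m} ys xs = subst (projs (m ↑ʳ_) [ ys ++ xs ]⇓*_)
  (trans (tabulate-cong (lookup-++ʳ ys xs)) (tabulate∘lookup xs)) (projs⇓ (m ↑ʳ_) (ys ++ xs))

-- eval s p xs runs p on xs with fuel s, where fuel bounds every unbounded
-- search by s + 1 candidates.  Results are encoded: 0 means "no result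
-- (yet)", suc y means "result y".

guard : ℕ → ℕ → ℕ
guard a v = cond a 0 v

allDefined : ∀ {m} → Vec ℕ m → ℕ
allDefined []       = 1
allDefined (v ∷ vs) = guard v (allDefined vs)

precStep : ∀ {n} → (Vec ℕ (suc (suc n)) → ℕ) → Vec ℕ (suc (suc n)) → ℕ
precStep H (k ∷ r ∷ xs) = guard r (H (k ∷ pred r ∷ xs))

iterate : ∀ {n} → (Vec ℕ n → ℕ) → (Vec ℕ (suc (suc n)) → ℕ) → ℕ → Vec ℕ n → ℕ
iterate G H zero    xs = G xs
iterate G H (suc k) xs = H (k ∷ iterate G H k xs ∷ xs)

-- search F j looks for the least zero among F 0 … F (j-1) of an encoded
-- function F.  State 1: all values so far are positive results; state
-- suc (suc y): y is the least zero; state 0: some value was undefined.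
searchStep : ℕ → ℕ → ℕ → ℕ
searchStep a j c = cond a a (cond (pred a) (cond c 0 (cond (pred c) (suc (suc j)) 1)) a)

search : (ℕ → ℕ) → ℕ → ℕ
search F zero    = 1
search F (suc j) = searchStep (search F j) j (F j)

mutual
  eval : ∀ {n} → ℕ → PR n → Vec ℕ n → ℕ
  eval s zer         xs = 1
  eval s succ        xs = suc (suc (head xs))
  eval s (proj i)    xs = suc (lookup xs i)
  eval s (comp f gs) xs = guard (allDefined (evals s gs xs)) (eval s f (map pred (evals s gs xs)))
  eval s (prec g h)  xs = iterate (eval s g) (precStep (eval s h)) (head xs) (tail xs)
  eval s (mu f)      xs = pred (search (λ z → eval s f (z ∷ xs)) (suc s))

  evals : ∀ {m n} → ℕ → Vec (PR n) m → Vec ℕ n → Vec ℕ m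
  evals s []       xs = []
  evals s (g ∷ gs) xs = eval s g xs ∷ evals s gs xs

-- evalP p takes the fuel as an extra first argument:
-- evalP p [ s ∷ xs ]⇓ eval s p xs.  This is what lets programs dovetail.

allDefinedP : ∀ {m k} → Vec (PR k) m → PR k
allDefinedP []       = one
allDefinedP (c ∷ cs) = ifz c zer (allDefinedP cs)

allDefinedP⇓ : ∀ {m k} {cs : Vec (PR k) m} {ys vs} →
               cs [ ys ]⇓* vs → allDefinedP cs [ ys ]⇓ allDefined vs
allDefinedP⇓ []⇓        = one⇓
allDefinedP⇓ (d ∷⇓ ds) = ifz⇓ d zer⇓ (allDefinedP⇓ ds)

decs : ∀ {m k} → Vec (PR k) m → Vec (PR k) m
decs []       = []
decs (c ∷ cs) = dec c ∷ decs cs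

decs⇓ : ∀ {m k} {cs : Vec (PR k) m} {ys vs} → cs [ ys ]⇓* vs → decs cs [ ys ]⇓* map pred vs
decs⇓ []⇓        = []⇓
decs⇓ (d ∷⇓ ds) = dec⇓ d ∷⇓ decs⇓ ds

searchStepP : ∀ {n} → PR n → PR n → PR n → PR n
searchStepP a j c = ifz a a (ifz (dec a) (ifz c zer (ifz (dec c) (inc (inc j)) one)) a)

searchStepP⇓ : ∀ {n} {a j c : PR n} {xs A J C} → a [ xs ]⇓ A → j [ xs ]⇓ J → c [ xs ]⇓ C →
               searchStepP a j c [ xs ]⇓ searchStep A J C
searchStepP⇓ da dj dc =
  ifz⇓ da da (ifz⇓ (dec⇓ da) (ifz⇓ dc zer⇓ (ifz⇓ (dec⇓ dc) (inc⇓ (inc⇓ dj)) one⇓)) da)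

mutual
  evalP : ∀ {n} → PR n → PR (suc n)
  evalP zer         = one
  evalP succ        = inc (inc (proj (# 1)))
  evalP (proj i)    = inc (proj (fs i))
  evalP (comp f gs) = ifz (allDefinedP (evalPs gs)) zer (comp (evalP f) (proj fz ∷ decs (evalPs gs)))
  evalP (prec g h)  = comp (prec (evalP g) (precStepP (evalP h))) (proj (# 1) ∷ proj fz ∷ projs (2 ↑ʳ_))
  evalP (mu f)      =
    dec (comp (prec one (searchP (evalP f))) (inc (proj fz) ∷ proj fz ∷ projs (1 ↑ʳ_)))

  evalPs : ∀ {m n} → Vec (PR n) m → Vec (PR (suc n)) m
  evalPs []       = []
  evalPs (g ∷ gs) = evalP g ∷ evalPs gs

  -- The step of  prec  inside evalP (prec g h): arguments (k, r, s, xs).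
  precStepP : ∀ {n} → PR (suc (suc (suc n))) → PR (suc (suc (suc n)))
  precStepP eh =
    ifz (proj (# 1)) zer (comp eh (proj (# 2) ∷ proj fz ∷ dec (proj (# 1)) ∷ projs (3 ↑ʳ_)))

  -- The step of the search inside evalP (mu f): arguments (j, state, s, xs).
  searchP : ∀ {n} → PR (suc (suc n)) → PR (suc (suc (suc n)))
  searchP ef = searchStepP (proj (# 1)) (proj fz) (comp ef (proj (# 2) ∷ proj fz ∷ projs (3 ↑ʳ_)))

mutual
  evalP⇓ : ∀ {n} (p : PR n) s xs → evalP p [ s ∷ xs ]⇓ eval s p xs
  evalP⇓ zer         s xs       = one⇓
  evalP⇓ succ        s (x ∷ []) = inc⇓ (inc⇓ proj⇓)
  evalP⇓ (proj i)    s xs       = inc⇓ proj⇓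
  evalP⇓ (comp f gs) s xs       =
    ifz⇓ (allDefinedP⇓ (evalPs⇓ gs s xs)) zer⇓
         (comp⇓ (proj⇓ ∷⇓ decs⇓ (evalPs⇓ gs s xs)) (evalP⇓ f s _))
  evalP⇓ (prec g h)  s (k ∷ xs) = comp⇓ (proj⇓ ∷⇓ (proj⇓ ∷⇓ dropArgs (s ∷ k ∷ []) xs)) (loop k)
    where
    loop : ∀ k → prec (evalP g) (precStepP (evalP h)) [ k ∷ s ∷ xs ]⇓
                 iterate (eval s g) (precStep (eval s h)) k xs
    loop zero    = prec0 (evalP⇓ g s xs)
    loop (suc k) = precS (loop k)
      (ifz⇓ proj⇓ zer⇓ (comp⇓ (proj⇓ ∷⇓ (proj⇓ ∷⇓ (dec⇓ proj⇓ ∷⇓ dropArgs (_ ∷ _ ∷ _ ∷ []) xs)))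
                              (evalP⇓ h s _)))
  evalP⇓ (mu f)      s xs       =
    dec⇓ (comp⇓ (inc⇓ proj⇓ ∷⇓ (proj⇓ ∷⇓ dropArgs (s ∷ []) xs)) (loop (suc s)))
    where
    loop : ∀ j → prec one (searchP (evalP f)) [ j ∷ s ∷ xs ]⇓ search (λ z → eval s f (z ∷ xs)) j
    loop zero    = prec0 one⇓
    loop (suc j) = precS (loop j)
      (searchStepP⇓ proj⇓ proj⇓
        (comp⇓ (proj⇓ ∷⇓ (proj⇓ ∷⇓ dropArgs (_ ∷ _ ∷ _ ∷ []) xs)) (evalP⇓ f s _)))

  evalPs⇓ : ∀ {m n} (gs : Vec (PR n) m) s xs → evalPs gs [ s ∷ xs ]⇓* evals s gs xs
  evalPs⇓ []       s xs = []⇓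
  evalPs⇓ (g ∷ gs) s xs = evalP⇓ g s xs ∷⇓ evalPs⇓ gs s xs

Positive : ℕ → Set
Positive v = ∃ λ k → v ≡ suc (suc k)

LeastZero : (ℕ → ℕ) → ℕ → Set
LeastZero F y = F y ≡ 1 × (∀ z → z < y → Positive (F z))

search-running : ∀ F j → search F j ≡ 1 → ∀ z → z < j → Positive (F z)
search-running F (suc j) e z z<j with search F j in ea
... | suc (suc a) with () ← e
... | suc zero with F j in ec
...   | zero          with () ← e
...   | suc zero      with () ← e
...   | suc (suc c) with m≤n⇒m<n∨m≡n (≤-pred z<j)
...     | inj₁ z<j' = search-running F j ea z z<j'
...     | inj₂ refl = c , ec

search-found : ∀ F j y → search F j ≡ suc (suc y) → y < j × LeastZero F y
search-found F (suc j) y e with search F j in ea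
search-found F (suc j) y refl | suc (suc a) with search-found F j y ea
... | lt , least = m<n⇒m<1+n lt , least
search-found F (suc j) y e    | suc zero with F j in ec
search-found F (suc j) y refl | suc zero | suc zero = ≤-refl , ec , search-running F j ea

search-before : ∀ F y → (∀ z → z < y → Positive (F z)) → ∀ j → j ≤ y → search F j ≡ 1
search-before F y pos zero    le = refl
search-before F y pos (suc j) le
  rewrite search-before F y pos j (<⇒≤ le) | proj₂ (pos j le) = refl

search-finds : ∀ F y → LeastZero F y → ∀ j → y < j → search F j ≡ suc (suc y)
search-finds F y (F≡1 , pos) (suc j) (s≤s le) with m≤n⇒m<n∨m≡n le
... | inj₂ refl rewrite search-before F y pos y ≤-refl | F≡1 = refl
... | inj₁ lt   rewrite search-finds F y (F≡1 , pos) j lt = refl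

eval-mu : ∀ {n} (f : PR (suc n)) s xs y → LeastZero (λ z → eval s f (z ∷ xs)) y → y ≤ s →
          eval s (mu f) xs ≡ suc y
eval-mu f s xs y least le = cong pred (search-finds _ y least (suc s) (s≤s le))

mutual
  sound : ∀ {n} (p : PR n) s xs {y} → eval s p xs ≡ suc y → p [ xs ]⇓ y
  sound zer         s xs       refl = zer⇓
  sound succ        s (x ∷ []) refl = succ⇓
  sound (proj i)    s xs       refl = proj⇓
  sound (comp f gs) s xs e with allDefined (evals s gs xs) in ea
  ... | suc _ = comp⇓ (sounds gs s xs ea) (sound f s _ e)
  sound (prec g h)  s (k ∷ xs) e = sound-iterate g h s k xs e
  sound (mu f)      s xs e with search (λ z → eval s f (z ∷ xs)) (suc s) in es
  sound (mu f) s xs refl | suc (suc y) with search-found _ (suc s) y es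
  ... | _ , at-y , pos =
    mu⇓ (sound f s _ at-y) λ z z<y → proj₁ (pos z z<y) , sound f s _ (proj₂ (pos z z<y))

  sound-iterate : ∀ {n} (g : PR n) h s k xs {y} →
                  iterate (eval s g) (precStep (eval s h)) k xs ≡ suc y → prec g h [ k ∷ xs ]⇓ y
  sound-iterate g h s zero    xs e = prec0 (sound g s xs e)
  sound-iterate g h s (suc k) xs e with iterate (eval s g) (precStep (eval s h)) k xs in er
  ... | suc r = precS (sound-iterate g h s k xs er) (sound h s _ e)

  sounds : ∀ {m n} (gs : Vec (PR n) m) s xs {a} → allDefined (evals s gs xs) ≡ suc a →
           gs [ xs ]⇓* map pred (evals s gs xs)
  sounds []       s xs e = []⇓
  sounds (g ∷ gs) s xs e with eval s g xs in eg
  ... | suc v = sound g s xs eg ∷⇓ sounds gs s xs e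

allDefined-results : ∀ {m} (ys : Vec ℕ m) → allDefined (map suc ys) ≡ 1
allDefined-results []       = refl
allDefined-results (y ∷ ys) = allDefined-results ys

pred-results : ∀ {m} (ys : Vec ℕ m) → map pred (map suc ys) ≡ ys
pred-results []       = refl
pred-results (y ∷ ys) = cong (y ∷_) (pred-results ys)

allDefined⇒results : ∀ {m} (vs : Vec ℕ m) {a} → allDefined vs ≡ suc a → vs ≡ map suc (map pred vs)
allDefined⇒results []           e = refl
allDefined⇒results (suc v ∷ vs) e = cong (suc v ∷_) (allDefined⇒results vs e)

eval-comp : ∀ {m n} (f : PR m) (gs : Vec (PR n) m) xs ys {s y} → evals s gs xs ≡ map suc ys →
            eval s f ys ≡ suc y → eval s (comp f gs) xs ≡ suc y
eval-comp f gs xs ys e₁ e₂ rewrite e₁ | allDefined-results ys | pred-results ys = e₂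

eval-precS : ∀ {n} (g : PR n) h k xs {s r y} → iterate (eval s g) (precStep (eval s h)) k xs ≡ suc r →
             eval s h (k ∷ r ∷ xs) ≡ suc y → eval s (prec g h) (suc k ∷ xs) ≡ suc y
eval-precS g h k xs e₁ e₂ rewrite e₁ = e₂

mutual
  mono : ∀ {n} (p : PR n) {s s'} xs {y} → s ≤ s' → eval s p xs ≡ suc y → eval s' p xs ≡ suc y
  mono zer         xs le e = e
  mono succ        xs le e = e
  mono (proj i)    xs le e = e
  mono (comp f gs) {s} xs le e with allDefined (evals s gs xs) in ea
  ... | suc a = eval-comp f gs xs _ (monos gs xs le (allDefined⇒results _ ea)) (mono f _ le e)
  mono (prec g h)  (k ∷ xs) le e = mono-iterate g h k xs le e
  mono (mu f) {s} {s'} xs le e with search (λ z → eval s f (z ∷ xs)) (suc s) in es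
  mono (mu f) {s} {s'} xs {y} le refl | suc (suc y) with search-found _ (suc s) y es
  ... | y<1+s , at-y , pos =
    eval-mu f s' xs y (mono f _ le at-y , λ z z<y → proj₁ (pos z z<y) , mono f _ le (proj₂ (pos z z<y)))
            (≤-trans (≤-pred y<1+s) le)

  mono-iterate : ∀ {n} (g : PR n) h {s s'} k xs {y} → s ≤ s' →
                 iterate (eval s g) (precStep (eval s h)) k xs ≡ suc y →
                 iterate (eval s' g) (precStep (eval s' h)) k xs ≡ suc y
  mono-iterate g h zero xs le e = mono g xs le e
  mono-iterate g h {s} (suc k) xs le e with iterate (eval s g) (precStep (eval s h)) k xs in er
  ... | suc r = eval-precS g h k xs (mono-iterate g h k xs le er) (mono h _ le e)

  monos : ∀ {m n} (gs : Vec (PR n) m) {s s'} xs {ys} → s ≤ s' →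
          evals s gs xs ≡ map suc ys → evals s' gs xs ≡ map suc ys
  monos []       xs {[]}     le e = refl
  monos (g ∷ gs) xs {y ∷ ys} le e = cong₂ _∷_ (mono g xs le (cong head e)) (monos gs xs le (cong tail e))

commonFuel : (P : ℕ → ℕ → Set) → (∀ {s s' z} → s ≤ s' → P s z → P s' z) →
             ∀ y → (∀ z → z < y → ∃ λ s → P s z) → ∃ λ S → ∀ z → z < y → P S z
commonFuel P mP zero    h = 0 , λ z ()
commonFuel P mP (suc y) h with commonFuel P mP y (λ z z<y → h z (m<n⇒m<1+n z<y)) | h y ≤-refl
... | S , hS | s , p = S ⊔ s , λ z z<y → combine z (≤-pred z<y)
  where
  combine : ∀ z → z ≤ y → P (S ⊔ s) z
  combine z le with m≤n⇒m<n∨m≡n le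
  ... | inj₁ lt   = mP (m≤m⊔n S s) (hS z lt)
  ... | inj₂ refl = mP (m≤n⊔m S s) p

mutual
  complete : ∀ {n} {p : PR n} {xs y} → p [ xs ]⇓ y → ∃ λ s → eval s p xs ≡ suc y
  complete zer⇓  = 0 , refl
  complete succ⇓ = 0 , refl
  complete proj⇓ = 0 , refl
  complete (comp⇓ {f = f} {gs = gs} {xs = xs} {ys = ys} ds df) with completes ds | complete df
  ... | s₁ , e₁ | s₂ , e₂ =
    s₁ ⊔ s₂ , eval-comp f gs xs ys (monos gs xs (m≤m⊔n s₁ s₂) e₁) (mono f ys (m≤n⊔m s₁ s₂) e₂)
  complete (prec0 d) = complete d
  complete (precS {g = g} {h = h} {xs = xs} {k = k} dr dh) with complete dr | complete dh
  ... | s₁ , e₁ | s₂ , e₂ =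
    s₁ ⊔ s₂ , eval-precS g h k xs (mono-iterate g h k xs (m≤m⊔n s₁ s₂) e₁) (mono h _ (m≤n⊔m s₁ s₂) e₂)
  complete (mu⇓ {f = f} {xs = xs} {y = y} d₀ pos) = complete-mu f xs y (complete d₀) fuels
    where
    fuels : ∀ z → z < y → ∃ λ s → Positive (eval s f (z ∷ xs))
    fuels z z<y with complete (proj₂ (pos z z<y))
    ... | s , e = s , proj₁ (pos z z<y) , e

  -- The search of  mu f  succeeds once the fuel covers the zero, all the
  -- earlier positive values, and the position y itself.
  complete-mu : ∀ {n} (f : PR (suc n)) xs y → (∃ λ s → eval s f (y ∷ xs) ≡ 1) →
                (∀ z → z < y → ∃ λ s → Positive (eval s f (z ∷ xs))) →
                ∃ λ s → eval s (mu f) xs ≡ suc y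
  complete-mu f xs y (s₀ , e₀) fuels
    with commonFuel (λ s z → Positive (eval s f (z ∷ xs))) (λ le (k , e) → k , mono f _ le e) y fuels
  ... | S , pos = s , eval-mu f s xs y least y≤s
    where
    s : ℕ
    s = s₀ ⊔ S ⊔ y
    s₀≤s : s₀ ≤ s
    s₀≤s = ≤-trans (m≤m⊔n s₀ S) (m≤m⊔n (s₀ ⊔ S) y)
    S≤s : S ≤ s
    S≤s = ≤-trans (m≤n⊔m s₀ S) (m≤m⊔n (s₀ ⊔ S) y)
    y≤s : y ≤ s
    y≤s = m≤n⊔m (s₀ ⊔ S) y
    least : LeastZero (λ z → eval s f (z ∷ xs)) y
    least = mono f _ s₀≤s e₀ , λ z z<y → proj₁ (pos z z<y) , mono f _ S≤s (proj₂ (pos z z<y))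

  completes : ∀ {m n} {gs : Vec (PR n) m} {xs ys} → gs [ xs ]⇓* ys → ∃ λ s → evals s gs xs ≡ map suc ys
  completes []⇓ = 0 , refl
  completes (_∷⇓_ {g = g} {gs = gs} {xs = xs} d ds) with complete d | completes ds
  ... | s₁ , e₁ | s₂ , e₂ =
    s₁ ⊔ s₂ , cong₂ _∷_ (mono g xs (m≤m⊔n s₁ s₂) e₁) (monos gs xs (m≤n⊔m s₁ s₂) e₂)

mutual
  deterministic : ∀ {n} {p : PR n} {xs a b} → p [ xs ]⇓ a → p [ xs ]⇓ b → a ≡ b
  deterministic zer⇓  zer⇓  = refl
  deterministic succ⇓ succ⇓ = refl
  deterministic proj⇓ proj⇓ = refl
  deterministic (comp⇓ ds df) (comp⇓ ds' df') with deterministics ds ds'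
  ... | refl = deterministic df df'
  deterministic (prec0 d) (prec0 d') = deterministic d d'
  deterministic (precS dr dh) (precS dr' dh') with deterministic dr dr'
  ... | refl = deterministic dh dh'
  deterministic (mu⇓ {y = y} d₀ pos) (mu⇓ {y = y'} d₀' pos') with <-cmp y y'
  ... | tri< y<y' _ _ with () ← deterministic d₀ (proj₂ (pos' y y<y'))
  ... | tri≈ _ y≡y' _ = y≡y'
  ... | tri> _ _ y'<y with () ← deterministic d₀' (proj₂ (pos y' y'<y))

  deterministics : ∀ {m n} {gs : Vec (PR n) m} {xs as bs} → gs [ xs ]⇓* as → gs [ xs ]⇓* bs → as ≡ bs
  deterministics []⇓        []⇓          = refl
  deterministics (d ∷⇓ ds) (d' ∷⇓ ds') = cong₂ _∷_ (deterministic d d') (deterministics ds ds')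

leastZeroOr : (F : ℕ → ℕ) → ∀ i →
              (∃ λ y → F y ≡ 0 × ∀ z → z < y → ∃ λ k → F z ≡ suc k) ⊎ (∀ z → z < i → ∃ λ k → F z ≡ suc k)
leastZeroOr F zero    = inj₂ (λ z ())
leastZeroOr F (suc i) with leastZeroOr F i
... | inj₁ found = inj₁ found
... | inj₂ pos with F i in e
...   | zero  = inj₁ (i , e , pos)
...   | suc k = inj₂ pos'
  where
  pos' : ∀ z → z < suc i → ∃ λ k → F z ≡ suc k
  pos' z lt with m≤n⇒m<n∨m≡n (≤-pred lt)
  ... | inj₁ lt'  = pos z lt'
  ... | inj₂ refl = k , e

module _ {n} {p : PR (suc n)} {xs : Vec ℕ n} (F : ℕ → ℕ) (p⇓ : ∀ z → p [ z ∷ xs ]⇓ F z) where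

  mu-halts : ∀ s → F s ≡ 0 → ∃ λ y → mu p [ xs ]⇓ y × F y ≡ 0
  mu-halts s e with leastZeroOr F (suc s)
  ... | inj₂ pos with () ← trans (sym e) (proj₂ (pos s ≤-refl))
  ... | inj₁ (y , ey , pos) =
    y , mu⇓ (subst (p [ y ∷ xs ]⇓_) ey (p⇓ y))
            (λ z lt → proj₁ (pos z lt) , subst (p [ z ∷ xs ]⇓_) (proj₂ (pos z lt)) (p⇓ z)) , ey

  mu-zero : ∀ {y} → mu p [ xs ]⇓ y → F y ≡ 0
  mu-zero (mu⇓ d₀ _) = deterministic (p⇓ _) d₀

-- x ∈ ⋃ A iff some enumerating program halts on x; the union is the domain of
-- the search for a fuel s with which one of them halts (dovetailing).

someHalts : ∀ {n} → (Fin n → PR 1) → ℕ → ℕ → ℕ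
someHalts {zero}  P s x = 1
someHalts {suc n} P s x = cond (eval s (P fz) (x ∷ [])) (someHalts (λ i → P (fs i)) s x) 0

someHaltsP : ∀ {n} → (Fin n → PR 1) → PR 2
someHaltsP {zero}  P = one
someHaltsP {suc n} P = ifz (evalP (P fz)) (someHaltsP (λ i → P (fs i))) zer

someHaltsP⇓ : ∀ {n} P x s → someHaltsP {n} P [ s ∷ x ∷ [] ]⇓ someHalts P s x
someHaltsP⇓ {zero}  P x s = one⇓
someHaltsP⇓ {suc n} P x s = ifz⇓ (evalP⇓ (P fz) s (x ∷ [])) (someHaltsP⇓ _ x s) zer⇓

someHalts-0⇒ : ∀ {n} P s x → someHalts {n} P s x ≡ 0 → ∃ λ i → ∃ λ y → eval s (P i) (x ∷ []) ≡ suc y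
someHalts-0⇒ {suc n} P s x e with eval s (P fz) (x ∷ []) in ev
... | suc y = fz , y , ev
... | zero with someHalts-0⇒ (λ i → P (fs i)) s x e
...   | i , y , e' = fs i , y , e'

⇒someHalts-0 : ∀ {n} P s x i y → eval s (P i) (x ∷ []) ≡ suc y → someHalts {n} P s x ≡ 0
⇒someHalts-0 {suc n} P s x fz     y e rewrite e = refl
⇒someHalts-0 {suc n} P s x (fs i) y e with eval s (P fz) (x ∷ [])
... | zero  = ⇒someHalts-0 (λ i → P (fs i)) s x i y e
... | suc _ = refl

unionCE : ∀ {n} (A : Fin n → Pred ℕ 0ℓ) → (∀ i → CE (A i)) → CE (⋃ A)
unionCE {n} A ce = mu (someHaltsP P) , λ x → mk⇔ (to x) (from x)
  where
  P : Fin n → PR 1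
  P i = proj₁ (ce i)
  to : ∀ x → ⋃ A x → Halts (mu (someHaltsP P)) x
  to x (i , a) with Equivalence.to (proj₂ (ce i) x) a
  ... | y , d with complete d
  ...   | s , e with mu-halts (λ z → someHalts P z x) (someHaltsP⇓ P x) s (⇒someHalts-0 P s x i y e)
  ...     | v , dv , _ = v , dv
  from : ∀ x → Halts (mu (someHaltsP P)) x → ⋃ A x
  from x (v , dv) with someHalts-0⇒ P v x (mu-zero (λ z → someHalts P z x) (someHaltsP⇓ P x) dv)
  ... | i , y , e = i , Equivalence.from (proj₂ (ce i) x) (y , sound (P i) v (x ∷ []) e)

IsInjective : (ℕ → ℕ) → Set
IsInjective f = ∀ a b → f a ≡ f b → a ≡ b

module _ (g : ℕ → ℕ) (step : ∀ k → g k < g (suc k)) where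

  increasing : ∀ a b → a < b → g a < g b
  increasing a (suc b) a<1+b with m≤n⇒m<n∨m≡n (≤-pred a<1+b)
  ... | inj₁ a<b  = <-trans (increasing a b a<b) (step b)
  ... | inj₂ refl = step a

  increasing⇒injective : IsInjective g
  increasing⇒injective a b e with <-cmp a b
  ... | tri< a<b _ _ = ⊥-elim (<-irrefl e (increasing a b a<b))
  ... | tri≈ _ a≡b _ = a≡b
  ... | tri> _ _ b<a = ⊥-elim (<-irrefl (sym e) (increasing b a b<a))

-- next m finds an element of the set above m in two searches: first a fuel
-- T within which p halts on one of the first T numbers above m, then the
-- least number above m on which p halts within fuel T.  Iterating next from 0
-- enumerates the set in increasing order.

candidate : ℕ → ℕ → ℕ
candidate m t = suc (m + t)

module Enumeration (p : PR 1) (inf : Infinite (Halts p)) where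

  haltsBy : ℕ → ℕ → ℕ
  haltsBy s x = cond (eval s p (x ∷ [])) 1 0

  haltsByP : PR 2
  haltsByP = ifz (evalP p) one zer

  haltsByP⇓ : ∀ s x → haltsByP [ s ∷ x ∷ [] ]⇓ haltsBy s x
  haltsByP⇓ s x = ifz⇓ (evalP⇓ p s (x ∷ [])) one⇓ zer⇓

  haltsBy⇒halts : ∀ s x → haltsBy s x ≡ 0 → Halts p x
  haltsBy⇒halts s x e with eval s p (x ∷ []) in ev
  ... | suc y = y , sound p s (x ∷ []) ev

  halts⇒haltsBy : ∀ x → Halts p x → ∃ λ s₀ → ∀ s → s₀ ≤ s → haltsBy s x ≡ 0
  halts⇒haltsBy x (y , d) with complete d
  ... | s₀ , e = s₀ , λ s le → cong (λ v → cond v 1 0) (mono p (x ∷ []) le e)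

  foundBelow : ℕ → ℕ → ℕ → ℕ
  foundBelow m s zero    = 1
  foundBelow m s (suc b) = cond (foundBelow m s b) 0 (haltsBy s (candidate m b))

  -- Arguments (b, m, s).
  foundBelowP : PR 3
  foundBelowP = prec one (ifz (proj (# 1)) zer
                              (comp haltsByP (proj (# 3) ∷ inc (add (proj (# 2)) (proj (# 0))) ∷ [])))

  foundBelowP⇓ : ∀ b m s → foundBelowP [ b ∷ m ∷ s ∷ [] ]⇓ foundBelow m s b
  foundBelowP⇓ zero    m s = prec0 one⇓
  foundBelowP⇓ (suc b) m s = precS (foundBelowP⇓ b m s)
    (ifz⇓ proj⇓ zer⇓ (comp⇓ (proj⇓ ∷⇓ (inc⇓ (add⇓ proj⇓ proj⇓) ∷⇓ []⇓)) (haltsByP⇓ s _)))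

  halts⇒found : ∀ m s b t → t < b → haltsBy s (candidate m t) ≡ 0 → foundBelow m s b ≡ 0
  halts⇒found m s (suc b) t t<1+b e with m≤n⇒m<n∨m≡n (≤-pred t<1+b)
  ... | inj₁ t<b rewrite halts⇒found m s b t t<b e = refl
  ... | inj₂ refl rewrite e with foundBelow m s b
  ...   | zero  = refl
  ...   | suc _ = refl

  found⇒halts : ∀ m s b → foundBelow m s b ≡ 0 → ∃ λ t → haltsBy s (candidate m t) ≡ 0
  found⇒halts m s (suc b) e with foundBelow m s b in eb
  ... | zero  = found⇒halts m s b eb
  ... | suc _ = b , e

  enoughFuel : ∀ m → ∃ λ S → foundBelow m S S ≡ 0
  enoughFuel m with inf (suc m)
  ... | x , m<x , hx with halts⇒haltsBy x hx
  ...   | s₀ , by = S , halts⇒found m S S t (m≤n⊔m s₀ (suc t)) accepted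
    where
    t S : ℕ
    t = x ∸ suc m
    S = s₀ ⊔ suc t
    x≡cand : x ≡ candidate m t
    x≡cand = sym (m+[n∸m]≡n m<x)
    accepted : haltsBy S (candidate m t) ≡ 0
    accepted = subst (λ v → haltsBy S v ≡ 0) x≡cand (by S (m≤m⊔n s₀ _))

  fuelP : PR 1
  fuelP = mu (comp foundBelowP (proj (# 0) ∷ proj (# 1) ∷ proj (# 0) ∷ []))

  fuelP⇓ : ∀ m → ∃ λ T → fuelP [ m ∷ [] ]⇓ T × foundBelow m T T ≡ 0
  fuelP⇓ m = mu-halts (λ s → foundBelow m s s)
               (λ s → comp⇓ (proj⇓ ∷⇓ (proj⇓ ∷⇓ (proj⇓ ∷⇓ []⇓))) (foundBelowP⇓ s m s))
               (proj₁ (enoughFuel m)) (proj₂ (enoughFuel m))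

  -- Arguments (t, m): is candidate m t accepted within the fuel of m?
  acceptedP : PR 2
  acceptedP = comp haltsByP (comp fuelP (proj (# 1) ∷ []) ∷ inc (add (proj (# 1)) (proj (# 0))) ∷ [])

  nextP : PR 1
  nextP = inc (add (proj (# 0)) (mu acceptedP))

  next : ∀ m → Σ ℕ λ v → nextP [ m ∷ [] ]⇓ v × m < v × Halts p v
  next m with fuelP⇓ m
  ... | T , dT , found with found⇒halts m T T found
  ...   | t₁ , e₁ with mu-halts (λ t → haltsBy T (candidate m t)) acceptedP⇓ t₁ e₁
    where
    acceptedP⇓ : ∀ t → acceptedP [ t ∷ m ∷ [] ]⇓ haltsBy T (candidate m t)
    acceptedP⇓ t = comp⇓ (comp⇓ (proj⇓ ∷⇓ []⇓) dT ∷⇓ (inc⇓ (add⇓ proj⇓ proj⇓) ∷⇓ []⇓)) (haltsByP⇓ T _)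
  ...     | t , dt , e = candidate m t , inc⇓ (add⇓ proj⇓ dt) , s≤s (m≤m+n m t) , haltsBy⇒halts T _ e

  enumerate : ℕ → ℕ
  enumerate zero    = proj₁ (next 0)
  enumerate (suc k) = proj₁ (next (enumerate k))

  enumerateP : PR 1
  enumerateP = prec (comp nextP (zer ∷ [])) (comp nextP (proj (# 1) ∷ []))

  enumerateP⇓ : ∀ k → enumerateP [ k ∷ [] ]⇓ enumerate k
  enumerateP⇓ zero    = prec0 (comp⇓ (zer⇓ ∷⇓ []⇓) (proj₁ (proj₂ (next 0))))
  enumerateP⇓ (suc k) =
    precS (enumerateP⇓ k) (comp⇓ (proj⇓ ∷⇓ []⇓) (proj₁ (proj₂ (next (enumerate k)))))

  enumerate-halts : ∀ k → Halts p (enumerate k)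
  enumerate-halts zero    = proj₂ (proj₂ (proj₂ (next 0)))
  enumerate-halts (suc k) = proj₂ (proj₂ (proj₂ (next (enumerate k))))

  enumerate-step : ∀ k → enumerate k < enumerate (suc k)
  enumerate-step k = proj₁ (proj₂ (proj₂ (next (enumerate k))))

injectiveEnumeration : (p : PR 1) → Infinite (Halts p) →
  Σ (ℕ → ℕ) λ e → Computable e × IsInjective e × (∀ k → Halts p (e k))
injectiveEnumeration p inf =
  enumerate , (enumerateP , enumerateP⇓) , increasing⇒injective enumerate enumerate-step , enumerate-halts
  where open Enumeration p inf

TailImage : (ℕ → ℕ) → ℕ → Pred ℕ 0ℓ
TailImage f N y = ∃ λ z → N ≤ z × f z ≡ y

-- distance a b is 0 exactly when a ≡ b; it is what a program can test.
distance : ℕ → ℕ → ℕ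
distance a b = (a ∸ b) + (b ∸ a)

distance-zero⇒≡ : ∀ a b → distance a b ≡ 0 → a ≡ b
distance-zero⇒≡ a b e =
  ≤-antisym (m∸n≡0⇒m≤n (m+n≡0⇒m≡0 (a ∸ b) e)) (m∸n≡0⇒m≤n (m+n≡0⇒n≡0 (a ∸ b) e))

distance-self : ∀ a → distance a a ≡ 0
distance-self a rewrite n∸n≡0 a = refl

-- y ∈ TailImage f N iff the search for t with f (N + t) = y halts.
tailImageCE : ∀ f → Computable f → ∀ N → CE (TailImage f N)
tailImageCE f (pf , pf⇓) N = mu matchP , λ y → mk⇔ (to y) (from y)
  where
  valueP : PR 2
  valueP = comp pf (add (const N) (proj (# 0)) ∷ [])
  matchP : PR 2
  matchP = add (monus valueP (proj (# 1))) (monus (proj (# 1)) valueP)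
  matchP⇓ : ∀ y t → matchP [ t ∷ y ∷ [] ]⇓ distance (f (N + t)) y
  matchP⇓ y t = add⇓ (monus⇓ value⇓ proj⇓) (monus⇓ proj⇓ value⇓)
    where
    value⇓ : valueP [ t ∷ y ∷ [] ]⇓ f (N + t)
    value⇓ = comp⇓ (add⇓ (const⇓ N) proj⇓ ∷⇓ []⇓) (pf⇓ _)
  to : ∀ y → TailImage f N y → Halts (mu matchP) y
  to y (z , N≤z , refl) with mu-halts (λ t → distance (f (N + t)) y) (matchP⇓ y) (z ∸ N) hit
    where
    hit : distance (f (N + (z ∸ N))) (f z) ≡ 0
    hit rewrite m+[n∸m]≡n N≤z = distance-self (f z)
  ... | t , dt , _ = t , dt
  from : ∀ y → Halts (mu matchP) y → TailImage f N y
  from y (t , dt) = N + t , m≤m+n N t , distance-zero⇒≡ _ _ (mu-zero _ (matchP⇓ y) dt)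

-- An injection takes a value ≥ m on some argument among N, …, N + m, by the
-- pigeonhole principle; so its tail images are infinite.
tailImageInfinite : ∀ f → IsInjective f → ∀ N → Infinite (TailImage f N)
tailImageInfinite f inj N m with any? (λ (i : Fin (suc m)) → m ≤? f (N + toℕ i))
... | yes (i , m≤) = f (N + toℕ i) , m≤ , N + toℕ i , m≤m+n N _ , refl
... | no none with pigeonhole (n<1+n m) (λ i → fromℕ< (below i))
  where
  below : ∀ (i : Fin (suc m)) → f (N + toℕ i) < m
  below i = ≰⇒> (λ m≤ → none (i , m≤))
...   | i , j , i<j , same = ⊥-elim (<-irrefl (+-cancelˡ-≡ N _ _ (inj _ _ values)) i<j)
  where
  values : f (N + toℕ i) ≡ f (N + toℕ j)
  values = trans (sym (toℕ-fromℕ< _)) (trans (cong toℕ same) (toℕ-fromℕ< _))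

-- If g never maps two different numbers into the same Aᵢ, then only finitely
-- many arguments are mapped into ⋃ A: n + 1 hits above each other would put
-- two of them into the same block.
boundedHits : ∀ {n} (A : Fin n → Pred ℕ 0ℓ) (g : ℕ → ℕ) →
              (∀ i x y → A i (g x) → A i (g y) → x ≡ y) →
              ¬ (∀ N → ∃ λ z → N ≤ z × ⋃ A (g z))
boundedHits {n} A g separated hit = twoHitsInOneBlock (pigeonhole (n<1+n n) (λ k → block (toℕ k)))
  where
  -- bound k lies above all earlier hits; hitAt k is the next hit, in block k.
  bound : ℕ → ℕ
  bound zero    = 0
  bound (suc k) = suc (proj₁ (hit (bound k)))
  hitAt : ℕ → ℕ
  hitAt k = proj₁ (hit (bound k))
  step : ∀ k → hitAt k < hitAt (suc k)
  step k = proj₁ (proj₂ (hit (bound (suc k))))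
  block : ℕ → Fin n
  block k = proj₁ (proj₂ (proj₂ (hit (bound k))))
  inBlock : ∀ k → A (block k) (g (hitAt k))
  inBlock k = proj₂ (proj₂ (proj₂ (hit (bound k))))
  twoHitsInOneBlock : ¬ (∃₂ λ (k l : Fin (suc n)) → toℕ k < toℕ l × block (toℕ k) ≡ block (toℕ l))
  twoHitsInOneBlock (k , l , k<l , sameBlock) =
    <-irrefl (increasing⇒injective hitAt step _ _ sameHit) k<l
    where
    inSameBlock : A (block (toℕ l)) (g (hitAt (toℕ k)))
    inSameBlock = subst (λ i → A i (g (hitAt (toℕ k)))) sameBlock (inBlock (toℕ k))
    sameHit : hitAt (toℕ k) ≡ hitAt (toℕ l)
    sameHit = separated (block (toℕ l)) _ _ inSameBlock (inBlock (toℕ l))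

reduction⇒notSimple : ∀ {n} (A : Fin n → Pred ℕ 0ℓ) → ω ≤c R[ A ] → ¬ Simple (⋃ A)
reduction⇒notSimple A (f , computable , reduces) (_ , _ , meets) = boundedHits A f separated hit
  where
  injective : IsInjective f
  injective x y e = Equivalence.from (reduces x y) (inj₁ e)
  separated : ∀ i x y → A i (f x) → A i (f y) → x ≡ y
  separated i x y a b = Equivalence.from (reduces x y) (inj₂ (i , a , b))
  hit : ∀ N → ∃ λ z → N ≤ z × ⋃ A (f z)
  hit N with meets (TailImage f N) (tailImageCE f computable N) (tailImageInfinite f injective N)
  ... | _ , (z , N≤z , refl) , u = z , N≤z , u

notSimple⇒avoidingCE : ExcludedMiddle 0ℓ → ∀ (U : Pred ℕ 0ℓ) → CE U → Infinite (Complement U) →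
                       ¬ Simple U → Σ (PR 1) λ p → Infinite (Halts p) × (∀ x → Halts p x → ¬ U x)
notSimple⇒avoidingCE em U ce inf notSimple = dne λ none → notSimple (ce , inf , meets none)
  where
  dne : DoubleNegationElimination 0ℓ
  dne = em⇒dne em
  meets : ¬ (Σ (PR 1) λ p → Infinite (Halts p) × (∀ x → Halts p x → ¬ U x)) →
          ∀ W → CE W → Infinite W → ∃ λ x → W x × U x
  meets none W (q , q-enumerates) infW =
    dne λ miss → none (q , infQ , λ x hx ux → miss (x , Equivalence.from (q-enumerates x) hx , ux))
    where
    infQ : Infinite (Halts q)
    infQ m with infW m
    ... | x , m≤x , wx = x , m≤x , Equivalence.to (q-enumerates x) wx

-- A computable injection whose values avoid every Aᵢ reduces ω to R_A:
-- R_A relates two of its values only when they are equal.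
avoidingInjection⇒reduction : ∀ {n} (A : Fin n → Pred ℕ 0ℓ) (f : ℕ → ℕ) → Computable f →
                              IsInjective f → (∀ x → ¬ ⋃ A (f x)) → ω ≤c R[ A ]
avoidingInjection⇒reduction A f computable injective avoids =
  f , computable , λ x y → mk⇔ (λ x≡y → inj₁ (cong f x≡y)) (back x y)
  where
  back : ∀ x y → R[ A ] (f x) (f y) → x ≡ y
  back x y (inj₁ e)           = injective x y e
  back x y (inj₂ (i , a , _)) = ⊥-elim (avoids x (i , a))

-- The theorem

proposition4p5 : ExcludedMiddle 0ℓ →
    (n : ℕ) (A : Fin n → Pred ℕ 0ℓ) →
    (∀ i → CE (A i)) → PairwiseDisjoint A →
    Infinite (Complement (⋃ A)) →
    (ω ≤c R[ A ]) ⇔ (¬ Simple (⋃ A))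
proposition4p5 em n A ce _ inf = mk⇔ (reduction⇒notSimple A) notSimple⇒reduction
  where
  notSimple⇒reduction : ¬ Simple (⋃ A) → ω ≤c R[ A ]
  notSimple⇒reduction notSimple with notSimple⇒avoidingCE em (⋃ A) (unionCE A ce) inf notSimple
  ... | p , infinite , avoids with injectiveEnumeration p infinite
  ... | f , computable , injective , inP =
    avoidingInjection⇒reduction A f computable injective (λ x → avoids (f x) (inP x))
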